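{- Let $p$ and $k$ be odd primes such that $p\equiv 1 \pmod{k}$ and $p\not\equiv 1\pmod{k^2}$. Then $D_{U(p)^k}(p)\le k$.
   Context: $\mathbb{Z}_p=\mathbb{Z}/p\mathbb{Z}$, $U(p)$ is its unit group and $U(p)^k=\{x^k:x\in U(p)\}$. For $A\subseteq\mathbb{Z}_p$, an $A$-weighted zero-sum subsequence of a sequence $(x_1,\ldots,x_m)$ in $\mathbb{Z}_p$ is given by a non-empty $I\subseteq[1,m]$ and $a_i\in A$ ($i\in I$) with $\sum_{i\in I}a_ix_i=0$. $D_A(p)$ is the least positive integer $m$ such that every sequence of length $m$ in $\mathbb{Z}_p$ has an $A$-weighted zero-sum subsequence. -}

module Defs where

open import Data.Nat using (ℕ; zero; suc; _+_; _*_; _^_; _≤_; _<_; NonZero)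
open import Data.Nat.DivMod using (_%_)
open import Data.Fin using (Fin; toℕ)
open import Data.Fin.Subset using (Subset; _∈_; Nonempty; Side; inside; outside)
open import Data.Vec using (_∷_)
open import Data.Product using (Σ; ∃; _×_; _,_)
open import Relation.Binary.PropositionalEquality using (_≡_; _≢_)

-- Elements of ℤ_p are represented by their residues, Fin p.
-- A weight set A ⊆ ℤ_p is a predicate on Fin p.

-- U(p)^k = { x^k : x ∈ U(p) } as a subset of ℤ_p (p prime, so U(p) = nonzero residues).
UnitPow : (p k : ℕ) .{{_ : NonZero p}} → Fin p → Set
UnitPow p k a = Σ (Fin p) λ x → (toℕ x ≢ 0) × ((toℕ x ^ k) % p ≡ toℕ a)

weightedSum : ∀ {p} (m : ℕ) → Subset m → (Fin m → Fin p) → (Fin m → Fin p) → ℕ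
weightedSum zero I a x = 0
weightedSum (suc m) (inside ∷ I) a x =
  toℕ (a Fin.zero) * toℕ (x Fin.zero) + weightedSum m I (λ i → a (Fin.suc i)) (λ i → x (Fin.suc i))
weightedSum (suc m) (outside ∷ I) a x =
  weightedSum m I (λ i → a (Fin.suc i)) (λ i → x (Fin.suc i))

-- The sequence x = (x_1,…,x_m) in ℤ_p has an A-weighted zero-sum subsequence:
-- a nonempty I ⊆ [1,m] and weights a_i ∈ A (i ∈ I) with Σ_{i∈I} a_i x_i = 0 in ℤ_p.
-- (Weights outside I are irrelevant; we take a : Fin m → Fin p.)
HasWeightedZeroSum : (p : ℕ) .{{_ : NonZero p}} → (Fin p → Set) → (m : ℕ) → (Fin m → Fin p) → Set
HasWeightedZeroSum p A m x =
  Σ (Subset m) λ I → Nonempty I × Σ (Fin m → Fin p) λ a →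
    (∀ i → i ∈ I → A (a i)) × (weightedSum m I a x % p ≡ 0)

AllHaveWZS : (p : ℕ) .{{_ : NonZero p}} → (Fin p → Set) → ℕ → Set
AllHaveWZS p A m = (x : Fin m → Fin p) → HasWeightedZeroSum p A m x

IsDavenportA : (p : ℕ) .{{_ : NonZero p}} → (Fin p → Set) → ℕ → Set
IsDavenportA p A d = (1 ≤ d) × AllHaveWZS p A d × (∀ m → 1 ≤ m → AllHaveWZS p A m → d ≤ m)

{-# OPTIONS --safe #-}
module Submission where

-- Write p − 1 = nk with k ∤ n and pick b with 1 + bk ≡ 0 (mod n). For a unit u the weight
-- (u^b)^k ∈ U(p)^k turns u into ζ(u) = u^(1+bk), and ζ(u)^k = 1 by Fermat's little theorem.
-- Among x₁, …, x_k, a zero term is a zero-sum by itself. If ζ(xᵢ) = ζ(xⱼ) for some i ≠ j, the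
-- oddness of k makes −(xⱼ^b)^k = (−xⱼ^b)^k a weight as well, and the pair cancels. Otherwise
-- the ζ(xᵢ) are k distinct roots of X^k − 1, so their sum, which is minus the coefficient of
-- X^(k−1), vanishes. Finally, having a zero-sum for every sequence of a given length is
-- decidable, so the least such length exists, and it is at most k.

open import Defs
open import Algebra.Bundles using (CommutativeSemiring)
open import Data.Empty using (⊥-elim)
open import Data.Fin using (Fin; zero; suc; toℕ; fromℕ; fromℕ<)
import Data.Fin.Properties as Fin
open import Data.Fin.Subset using (Subset; _∈_; ⁅_⁆; _∪_; ⊤; ⊥; inside; outside)
open import Data.Fin.Subset.Properties
  using (∪-identityˡ; ∪-identityʳ; anySubset?; nonempty?; _∈?_; x∈⁅x⁆; x∈p∪q⁺; ∈⊤)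
open import Data.Nat
open import Data.Nat.Combinatorics using (_C_; nCn≡1; k![n∸k]!∣n!)
open import Data.Nat.Combinatorics.Specification using (nCk≡n!/k![n-k]!)
open import Data.Nat.Coprimality using (Coprime; coprime-Bézout)
open import Data.Nat.DivMod
open import Data.Nat.Divisibility
open import Data.Nat.GCD using (module Bézout)
open import Data.Nat.Induction using (<-rec)
open import Data.Nat.Primality
open import Data.Nat.Properties
open import Data.Nat.Tactic.RingSolver using (solve-∀)
open import Data.Product using (Σ; ∃; ∃₂; _×_; _,_)
open import Data.Sum as Sum using (_⊎_; inj₁; inj₂)
open import Data.Vec using (Vec; []; _∷_; replicate)
import Data.Vec.Functional as V
open import Data.Vec.Functional.Properties using (updateAt-updates; updateAt-minimal)
open import Function using (_∘_; const)
open import Function.Definitions using (Injective)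
open import Relation.Binary.Bundles using (Setoid)
import Relation.Binary.Construct.On as On
open import Relation.Binary.PropositionalEquality
open import Relation.Nullary using (¬_; Dec; yes; no; contradiction)
open import Relation.Nullary.Decidable using (_×-dec_; _→-dec_; ¬?; map′; decidable-stable)
open import Relation.Unary using (Decidable)
open import Algebra.Properties.Monoid.Sum (CommutativeSemiring.+-monoid +-*-commutativeSemiring)
  using (sum; sum-cong-≗)
open import Algebra.Definitions.RawMonoid (CommutativeSemiring.+-rawMonoid +-*-commutativeSemiring)
  using () renaming (_×_ to _×ᵐ_)
open import Algebra.Definitions.RawSemiring (CommutativeSemiring.rawSemiring +-*-commutativeSemiring)
  using () renaming (_^_ to _^ˢ_)
open import Algebra.Properties.CommutativeSemiring.Binomial +-*-commutativeSemiring using (theorem)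

m%n≡o%n⇒n∣m∸o : ∀ m o n .{{_ : NonZero n}} → m % n ≡ o % n → n ∣ m ∸ o
m%n≡o%n⇒n∣m∸o m o n m%n≡o%n = divides (m / n ∸ o / n) (begin
  m ∸ o                                       ≡⟨ cong₂ _∸_ (m≡m%n+[m/n]*n m n) (m≡m%n+[m/n]*n o n) ⟩
  (m % n + m / n * n) ∸ (o % n + o / n * n)   ≡⟨ cong (λ r → (r + m / n * n) ∸ (o % n + o / n * n)) m%n≡o%n ⟩
  (o % n + m / n * n) ∸ (o % n + o / n * n)   ≡⟨ [m+n]∸[m+o]≡n∸o (o % n) _ _ ⟩
  m / n * n ∸ o / n * n                       ≡⟨ *-distribʳ-∸ n (m / n) (o / n) ⟨
  (m / n ∸ o / n) * n                         ∎)
  where open ≡-Reasoning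

n∣m∸o⇒m%n≡o%n : ∀ {m o} n .{{_ : NonZero n}} → o ≤ m → n ∣ m ∸ o → m % n ≡ o % n
n∣m∸o⇒m%n≡o%n {m} {o} n o≤m (divides q m∸o≡q*n) = begin
  m % n               ≡⟨ cong (_% n) (m+[n∸m]≡n o≤m) ⟨
  (o + (m ∸ o)) % n   ≡⟨ cong (λ d → (o + d) % n) m∸o≡q*n ⟩
  (o + q * n) % n     ≡⟨ [m+kn]%n≡m%n o q n ⟩
  o % n               ∎
  where open ≡-Reasoning

module Modular (p : ℕ) .{{_ : NonZero p}} where

  infix 4 _≈_ _≈?_
  _≈_ : ℕ → ℕ → Set
  a ≈ b = a % p ≡ b % p

  _≈?_ : ∀ a b → Dec (a ≈ b)
  a ≈? b = a % p ≟ b % p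

  ≈-setoid : Setoid _ _
  ≈-setoid = On.setoid (setoid ℕ) (_% p)

  open Setoid ≈-setoid public using () renaming (refl to ≈-refl; sym to ≈-sym; trans to ≈-trans)
  open import Relation.Binary.Reasoning.Setoid ≈-setoid

  ≡⇒≈ : ∀ {a b} → a ≡ b → a ≈ b
  ≡⇒≈ = cong (_% p)

  %-≈ : ∀ a → a % p ≈ a
  %-≈ a = m%n%n≡m%n a p

  0%p≡0 : 0 % p ≡ 0
  0%p≡0 = m*n%n≡0 0 p

  ≈0⇒%≡0 : ∀ {a} → a ≈ 0 → a % p ≡ 0
  ≈0⇒%≡0 a≈0 = trans a≈0 0%p≡0

  p≈0 : p ≈ 0
  p≈0 = trans (n%n≡0 p) (sym 0%p≡0)

  ∣⇒≈0 : ∀ {a} → p ∣ a → a ≈ 0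
  ∣⇒≈0 {a} p∣a = trans (n∣m⇒m%n≡0 a p p∣a) (sym 0%p≡0)

  ≈0⇒∣ : ∀ {a} → a ≈ 0 → p ∣ a
  ≈0⇒∣ {a} a≈0 = m%n≡0⇒n∣m a p (≈0⇒%≡0 a≈0)

  +-cong : ∀ {a b c d} → a ≈ b → c ≈ d → a + c ≈ b + d
  +-cong {a} {b} {c} {d} a≈b c≈d = begin
    a + c           ≈⟨ %-distribˡ-+ a c p ⟩
    a % p + c % p   ≡⟨ cong₂ _+_ a≈b c≈d ⟩
    b % p + d % p   ≈⟨ %-distribˡ-+ b d p ⟨
    b + d           ∎

  *-cong : ∀ {a b c d} → a ≈ b → c ≈ d → a * c ≈ b * d
  *-cong {a} {b} {c} {d} a≈b c≈d = begin
    a * c           ≈⟨ %-distribˡ-* a c p ⟩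
    a % p * (c % p) ≡⟨ cong₂ _*_ a≈b c≈d ⟩
    b % p * (d % p) ≈⟨ %-distribˡ-* b d p ⟨
    b * d           ∎

  ^-congˡ : ∀ {a b} n → a ≈ b → a ^ n ≈ b ^ n
  ^-congˡ zero    a≈b = refl
  ^-congˡ (suc n) a≈b = *-cong a≈b (^-congˡ n a≈b)

  sum-cong : ∀ {n} {f g : V.Vector ℕ n} → (∀ i → f i ≈ g i) → sum f ≈ sum g
  sum-cong {zero}  f≈g = refl
  sum-cong {suc n} f≈g = +-cong (f≈g zero) (sum-cong (f≈g ∘ suc))

  +-cancelʳ-≈ : ∀ {a b} c → a + c ≈ b + c → a ≈ b
  +-cancelʳ-≈ {a} {b} c a+c≈b+c = begin
    a                       ≈⟨ [m+kn]%n≡m%n a c p ⟨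
    a + c * p               ≡⟨ regroup a ⟩
    a + c + (p ∸ 1) * c     ≈⟨ +-cong a+c≈b+c (≈-refl {(p ∸ 1) * c}) ⟩
    b + c + (p ∸ 1) * c     ≡⟨ regroup b ⟨
    b + c * p               ≈⟨ [m+kn]%n≡m%n b c p ⟩
    b                       ∎
    where
    regroup : ∀ x → x + c * p ≡ x + c + (p ∸ 1) * c
    regroup x = trans (cong (λ q → x + c * q) (sym (suc-pred p)))
      (trans (cong (x +_) (*-comm c (suc (p ∸ 1)))) (sym (+-assoc x c _)))

  neg : ℕ → ℕ
  neg v = (p ∸ 1) * v

  +-neg≈0 : ∀ v → v + neg v ≈ 0
  +-neg≈0 v = begin
    v + (p ∸ 1) * v   ≡⟨ cong (_* v) (suc-pred p) ⟩
    p * v             ≈⟨ ∣⇒≈0 (m∣m*n v) ⟩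
    0                 ∎

  neg-≉0 : ∀ {v} → ¬ v ≈ 0 → ¬ neg v ≈ 0
  neg-≉0 {v} v≉0 neg-v≈0 = v≉0 (begin
    v             ≡⟨ +-identityʳ v ⟨
    v + 0         ≈⟨ +-cong (≈-refl {v}) (≈-sym neg-v≈0) ⟩
    v + neg v     ≈⟨ +-neg≈0 v ⟩
    0             ∎)

  m+n≈0⇒m*m≈n*n : ∀ {w v} → w + v ≈ 0 → w * w ≈ v * v
  m+n≈0⇒m*m≈n*n {w} {v} w+v≈0 = +-cancelʳ-≈ (w * v) (begin
    w * w + w * v   ≡⟨ *-distribˡ-+ w w v ⟨
    w * (w + v)     ≈⟨ *-cong (≈-refl {w}) w+v≈0 ⟩
    w * 0           ≡⟨ trans (*-zeroʳ w) (sym (*-zeroʳ v)) ⟩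
    v * 0           ≈⟨ *-cong (≈-refl {v}) (≈-sym w+v≈0) ⟩
    v * (w + v)     ≡⟨ *-distribˡ-+ v w v ⟩
    v * w + v * v   ≡⟨ trans (+-comm (v * w) (v * v)) (cong (v * v +_) (*-comm v w)) ⟩
    v * v + w * v   ∎)

  odd-^-+≈0 : ∀ {w v} k → ¬ 2 ∣ k → w + v ≈ 0 → w ^ k + v ^ k ≈ 0
  odd-^-+≈0 zero odd _ = contradiction (divides-refl 0) odd
  odd-^-+≈0 {w} {v} (suc zero) _ w+v≈0 = ≈-trans (≡⇒≈ (cong₂ _+_ (*-identityʳ w) (*-identityʳ v))) w+v≈0
  odd-^-+≈0 {w} {v} (suc (suc k)) odd w+v≈0 = begin
    w * (w * w ^ k) + v * (v * v ^ k)   ≡⟨ cong₂ _+_ (*-assoc w w _) (*-assoc v v _) ⟨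
    w * w * w ^ k + v * v * v ^ k       ≈⟨ +-cong (*-cong w²≈v² (≈-refl {w ^ k})) (≈-refl {v * v * v ^ k}) ⟩
    v * v * w ^ k + v * v * v ^ k       ≡⟨ *-distribˡ-+ (v * v) _ _ ⟨
    v * v * (w ^ k + v ^ k)             ≈⟨ *-cong (≈-refl {v * v}) (odd-^-+≈0 k (odd ∘ ∣m∣n⇒∣m+n ∣-refl) w+v≈0) ⟩
    v * v * 0                           ≡⟨ *-zeroʳ (v * v) ⟩
    0                                   ∎
    where
    w²≈v² : w * w ≈ v * v
    w²≈v² = m+n≈0⇒m*m≈n*n {w} {v} w+v≈0

×ᵐ≡* : ∀ n x → n ×ᵐ x ≡ n * x
×ᵐ≡* zero    x = refl
×ᵐ≡* (suc n) x = cong (x +_) (×ᵐ≡* n x)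

^ˢ≡^ : ∀ x n → x ^ˢ n ≡ x ^ n
^ˢ≡^ x zero    = refl
^ˢ≡^ x (suc n) = cong (x *_) (^ˢ≡^ x n)

binomialTerm : ∀ n x y → Fin (suc n) → ℕ
binomialTerm n x y i = (n C toℕ i) * (x ^ toℕ i * y ^ (n ∸ toℕ i))

binomialTheorem : ∀ n x y → (x + y) ^ n ≡ sum (binomialTerm n x y)
binomialTheorem n x y = begin
  (x + y) ^ n     ≡⟨ ^ˢ≡^ (x + y) n ⟨
  (x + y) ^ˢ n    ≡⟨ theorem n x y ⟩
  sum {suc n} (λ i → (n C toℕ i) ×ᵐ (x ^ˢ toℕ i * y ^ˢ (n ∸ toℕ i)))
    ≡⟨ sum-cong-≗ {suc n} (λ i → trans (×ᵐ≡* (n C toℕ i) _)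
         (cong₂ (λ a b → (n C toℕ i) * (a * b)) (^ˢ≡^ x (toℕ i)) (^ˢ≡^ y (n ∸ toℕ i)))) ⟩
  sum (binomialTerm n x y) ∎
  where open ≡-Reasoning

binomialTerm-first : ∀ m x y → binomialTerm (suc m) x y zero ≡ y ^ suc m
binomialTerm-first m x y = trans (*-identityˡ _) (*-identityˡ _)

binomialTerm-last : ∀ m x y → binomialTerm (suc m) x y (fromℕ (suc m)) ≡ x ^ suc m
binomialTerm-last m x y = begin
  (n C toℕ (fromℕ n)) * (x ^ toℕ (fromℕ n) * y ^ (n ∸ toℕ (fromℕ n)))
                                   ≡⟨ cong (λ j → (n C j) * (x ^ j * y ^ (n ∸ j))) (Fin.toℕ-fromℕ n) ⟩
  (n C n) * (x ^ n * y ^ (n ∸ n))  ≡⟨ cong₂ (λ c e → c * (x ^ n * y ^ e)) (nCn≡1 n) (n∸n≡0 n) ⟩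
  1 * (x ^ n * 1)                  ≡⟨ trans (*-identityˡ _) (*-identityʳ _) ⟩
  x ^ n                            ∎
  where
  open ≡-Reasoning
  n : ℕ
  n = suc m

-- c₀ ∷ c₁ ∷ … ∷ c_{d−1} encodes the monic polynomial c₀ + c₁X + ⋯ + c_{d−1}X^(d−1) + X^d;
-- its subleading coefficient is c_{d−1}.
evalMonic : ∀ {d} → Vec ℕ d → ℕ → ℕ
evalMonic []       y = 1
evalMonic (c ∷ cs) y = c + y * evalMonic cs y

subleading : ∀ {d} → Vec ℕ (suc d) → ℕ
subleading (c ∷ [])     = c
subleading (_ ∷ c ∷ cs) = subleading (c ∷ cs)

-- The quotient of f(X) − f(s) by X − s.
quotientBy : ∀ {d} → ℕ → Vec ℕ (suc d) → Vec ℕ d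
quotientBy s (_ ∷ [])     = []
quotientBy s (_ ∷ c ∷ cs) = evalMonic (c ∷ cs) s ∷ quotientBy s (c ∷ cs)

quotientBy-spec : ∀ {d} s (f : Vec ℕ (suc d)) y →
                  evalMonic f y + s * evalMonic (quotientBy s f) y ≡ y * evalMonic (quotientBy s f) y + evalMonic f s
quotientBy-spec s (c ∷ [])      y = regroup c y s
  where
  regroup : ∀ c y s → c + y * 1 + s * 1 ≡ y * 1 + (c + s * 1)
  regroup = solve-∀
quotientBy-spec s (c ∷ c′ ∷ cs) y = begin
  (c + y * g y) + s * (g s + y * h y)   ≡⟨ regroup₁ c y s (g y) (g s) (h y) ⟩
  c + y * (g y + s * h y) + s * g s     ≡⟨ cong (λ t → c + y * t + s * g s) (quotientBy-spec s (c′ ∷ cs) y) ⟩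
  c + y * (y * h y + g s) + s * g s     ≡⟨ regroup₂ c y s (g s) (h y) ⟩
  y * (g s + y * h y) + (c + s * g s)   ∎
  where
  open ≡-Reasoning
  g h : ℕ → ℕ
  g = evalMonic (c′ ∷ cs)
  h = evalMonic (quotientBy s (c′ ∷ cs))
  regroup₁ : ∀ c y s gy gs hy → (c + y * gy) + s * (gs + y * hy) ≡ c + y * (gy + s * hy) + s * gs
  regroup₁ = solve-∀
  regroup₂ : ∀ c y s gs hy → c + y * (y * hy + gs) + s * gs ≡ y * (gs + y * hy) + (c + s * gs)
  regroup₂ = solve-∀

subleading-quotientBy : ∀ {d} s (f : Vec ℕ (suc (suc d))) → subleading (quotientBy s f) ≡ subleading f + s
subleading-quotientBy s (_ ∷ c ∷ [])      = cong (c +_) (*-identityʳ s)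
subleading-quotientBy s (_ ∷ c ∷ c′ ∷ cs) = subleading-quotientBy s (c ∷ c′ ∷ cs)

evalMonic-replicate : ∀ d y → evalMonic (replicate d 0) y ≡ y ^ d
evalMonic-replicate zero    y = refl
evalMonic-replicate (suc d) y = cong (y *_) (evalMonic-replicate d y)

subleading-0∷replicate : ∀ d → subleading (0 ∷ replicate d 0) ≡ 0
subleading-0∷replicate zero    = refl
subleading-0∷replicate (suc d) = subleading-0∷replicate d

module PrimeModular {p : ℕ} (prime : Prime p) where

  private instance
    p≢0 : NonZero p
    p≢0 = prime⇒nonZero prime

  open Modular p public
  open import Relation.Binary.Reasoning.Setoid ≈-setoid

  p∤1 : ¬ p ∣ 1
  p∤1 = nonTrivial⇒≢1 {{prime⇒nonTrivial prime}} ∘ ∣1⇒≡1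

  1≉0 : ¬ 1 ≈ 0
  1≉0 = p∤1 ∘ ≈0⇒∣

  m*n≈0⇒m≈0∨n≈0 : ∀ m n → m * n ≈ 0 → m ≈ 0 ⊎ n ≈ 0
  m*n≈0⇒m≈0∨n≈0 m n mn≈0 = Sum.map ∣⇒≈0 ∣⇒≈0 (euclidsLemma m n prime (≈0⇒∣ mn≈0))

  ^-≉0 : ∀ {a} n → ¬ a ≈ 0 → ¬ a ^ n ≈ 0
  ^-≉0 zero        a≉0 = 1≉0
  ^-≉0 {a} (suc n) a≉0 = Sum.[ a≉0 , ^-≉0 n a≉0 ] ∘ m*n≈0⇒m≈0∨n≈0 a (a ^ n)

  private
    ≥-*-cancelʳ-≈ : ∀ {a b c} → b ≤ a → a * c ≈ b * c → a ≈ b ⊎ c ≈ 0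
    ≥-*-cancelʳ-≈ {a} {b} {c} b≤a ac≈bc = Sum.map (n∣m∸o⇒m%n≡o%n p b≤a) ∣⇒≈0
      (euclidsLemma (a ∸ b) c prime
        (subst (p ∣_) (sym (*-distribʳ-∸ c a b)) (m%n≡o%n⇒n∣m∸o (a * c) (b * c) p ac≈bc)))

  *-cancelʳ-≈ : ∀ {a b c} → a * c ≈ b * c → a ≈ b ⊎ c ≈ 0
  *-cancelʳ-≈ {a} {b} ac≈bc with ≤-total b a
  ... | inj₁ b≤a = ≥-*-cancelʳ-≈ b≤a ac≈bc
  ... | inj₂ a≤b = Sum.map₁ ≈-sym (≥-*-cancelʳ-≈ a≤b (≈-sym ac≈bc))

  p∤! : ∀ {m} → m < p → ¬ p ∣ m !
  p∤! {zero}  _   = p∤1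
  p∤! {suc m} m<p p∣m! with euclidsLemma (suc m) (m !) prime p∣m!
  ... | inj₁ p∣1+m = <⇒≱ m<p (∣⇒≤ p∣1+m)
  ... | inj₂ p∣m!  = p∤! (<-trans (n<1+n m) m<p) p∣m!

  p∣pCi : ∀ {i} → 0 < i → i < p → p ∣ p C i
  p∣pCi {i} 0<i i<p = Sum.fromInj₁ (⊥-elim ∘ p∤i![p∸i]!)
    (euclidsLemma (p C i) (i ! * (p ∸ i) !) prime (subst (p ∣_) (sym pCi*i![p∸i]!≡p!) p∣p!))
    where
    instance
      i![p∸i]!≢0 : NonZero (i ! * (p ∸ i) !)
      i![p∸i]!≢0 = i !* (p ∸ i) !≢0
    pCi*i![p∸i]!≡p! : (p C i) * (i ! * (p ∸ i) !) ≡ p !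
    pCi*i![p∸i]!≡p! = trans (cong (_* (i ! * (p ∸ i) !)) (nCk≡n!/k![n-k]! (<⇒≤ i<p)))
                            (m/n*n≡m (k![n∸k]!∣n! (<⇒≤ i<p)))
    p∣p! : p ∣ p !
    p∣p! = subst (λ q → q ∣ q !) (suc-pred p) (m∣m*n (pred p !))
    p∤i![p∸i]! : ¬ p ∣ i ! * (p ∸ i) !
    p∤i![p∸i]! = Sum.[ p∤! i<p , p∤! (∸-monoʳ-< 0<i (<⇒≤ i<p)) ] ∘ euclidsLemma (i !) ((p ∸ i) !) prime

  sum≈last : ∀ n (f : Fin (suc n) → ℕ) → (∀ i → toℕ i < n → f i ≈ 0) → sum f ≈ f (fromℕ n)
  sum≈last zero    f _     = ≡⇒≈ (+-identityʳ (f zero))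
  sum≈last (suc n) f f<n≈0 =
    +-cong (f<n≈0 zero z<s) (sum≈last n (f ∘ suc) (λ i i<n → f<n≈0 (suc i) (s<s i<n)))

  ^-distribʳ-+-≈ : ∀ n → 0 < n → (∀ {i} → 0 < i → i < n → p ∣ n C i) → ∀ x y → (x + y) ^ n ≈ x ^ n + y ^ n
  ^-distribʳ-+-≈ n@(suc m) _ p∣nCi x y = begin
    (x + y) ^ n                      ≡⟨ binomialTheorem n x y ⟩
    term zero + sum (term ∘ suc)     ≈⟨ +-cong (≈-refl {term zero}) (sum≈last m (term ∘ suc) inner≈0) ⟩
    term zero + term (suc (fromℕ m)) ≡⟨ cong₂ _+_ (binomialTerm-first m x y) (binomialTerm-last m x y) ⟩
    y ^ n + x ^ n                    ≡⟨ +-comm (y ^ n) (x ^ n) ⟩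
    x ^ n + y ^ n                    ∎
    where
    term : Fin (suc n) → ℕ
    term = binomialTerm n x y
    inner≈0 : ∀ i → toℕ i < m → term (suc i) ≈ 0
    inner≈0 i i<m = ∣⇒≈0 (∣m⇒∣m*n _ (p∣nCi z<s (s<s i<m)))

  freshman's-dream : ∀ x y → (x + y) ^ p ≈ x ^ p + y ^ p
  freshman's-dream = ^-distribʳ-+-≈ p (>-nonZero⁻¹ p) p∣pCi

  fermat-^p : ∀ a → a ^ p ≈ a
  fermat-^p zero    = ≡⇒≈ (cong (0 ^_) (sym (suc-pred p)))
  fermat-^p (suc a) = begin
    (1 + a) ^ p      ≡⟨ cong (_^ p) (+-comm 1 a) ⟩
    (a + 1) ^ p      ≈⟨ freshman's-dream a 1 ⟩
    a ^ p + 1 ^ p    ≈⟨ +-cong (fermat-^p a) (≡⇒≈ (^-zeroˡ p)) ⟩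
    a + 1            ≡⟨ +-comm a 1 ⟩
    1 + a            ∎

  fermat-^[p∸1] : ∀ {a} → ¬ a ≈ 0 → a ^ (p ∸ 1) ≈ 1
  fermat-^[p∸1] {a} a≉0 = Sum.fromInj₁ (⊥-elim ∘ a≉0) (*-cancelʳ-≈ {a ^ (p ∸ 1)} {1} (begin
    a ^ (p ∸ 1) * a   ≡⟨ *-comm _ a ⟩
    a ^ suc (p ∸ 1)   ≡⟨ cong (a ^_) (suc-pred p) ⟩
    a ^ p             ≈⟨ fermat-^p a ⟩
    a                 ≡⟨ *-identityˡ a ⟨
    1 * a             ∎))

  sum-roots+subleading≈0 : ∀ {d} (f : Vec ℕ (suc d)) (r : Fin (suc d) → ℕ) →
                           (∀ i → evalMonic f (r i) ≈ 0) → Injective _≡_ _≈_ r → sum r + subleading f ≈ 0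
  sum-roots+subleading≈0 {zero} (c ∷ []) r roots _ = begin
    r zero + 0 + c   ≡⟨ cong (_+ c) (+-identityʳ (r zero)) ⟩
    r zero + c       ≡⟨ +-comm (r zero) c ⟩
    c + r zero       ≡⟨ cong (c +_) (*-identityʳ (r zero)) ⟨
    c + r zero * 1   ≈⟨ roots zero ⟩
    0                ∎
  sum-roots+subleading≈0 {suc d} f r roots r-injective = begin
    r₀ + sum (r ∘ suc) + subleading f             ≡⟨ regroup r₀ (sum (r ∘ suc)) (subleading f) ⟩
    sum (r ∘ suc) + (subleading f + r₀)           ≡⟨ cong (sum (r ∘ suc) +_) (subleading-quotientBy r₀ f) ⟨
    sum (r ∘ suc) + subleading (quotientBy r₀ f)  ≈⟨ sum-roots+subleading≈0 (quotientBy r₀ f) (r ∘ suc) quotient-roots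
                                                       (Fin.suc-injective ∘ r-injective) ⟩
    0                                             ∎
    where
    r₀ : ℕ
    r₀ = r zero
    regroup : ∀ a b c → a + b + c ≡ b + (c + a)
    regroup = solve-∀
    quotient-roots : ∀ i → evalMonic (quotientBy r₀ f) (r (suc i)) ≈ 0
    quotient-roots i = Sum.fromInj₂ (λ r₀≈y → contradiction (r-injective r₀≈y) λ ()) (*-cancelʳ-≈ {r₀} {y} r₀*q≈y*q)
      where
      y q : ℕ
      y = r (suc i)
      q = evalMonic (quotientBy r₀ f) y
      r₀*q≈y*q : r₀ * q ≈ y * q
      r₀*q≈y*q = +-cancelʳ-≈ 0 (begin
        r₀ * q + 0                 ≡⟨ +-comm (r₀ * q) 0 ⟩
        0 + r₀ * q                 ≈⟨ +-cong (≈-sym (roots (suc i))) (≈-refl {r₀ * q}) ⟩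
        evalMonic f y + r₀ * q     ≡⟨ quotientBy-spec r₀ f y ⟩
        y * q + evalMonic f r₀     ≈⟨ +-cong (≈-refl {y * q}) (roots zero) ⟩
        y * q + 0                  ∎)

  sum-rootsOfUnity≈0 : ∀ {k} → 2 ≤ k → (r : Fin k → ℕ) → (∀ i → r i ^ k ≈ 1) → Injective _≡_ _≈_ r → sum r ≈ 0
  sum-rootsOfUnity≈0 {suc (suc d)} (s≤s (s≤s z≤n)) r r^k≈1 r-injective = begin
    sum r                   ≡⟨ +-identityʳ (sum r) ⟨
    sum r + 0               ≡⟨ cong (sum r +_) (subleading-0∷replicate d) ⟨
    sum r + subleading Xᵏ-1 ≈⟨ sum-roots+subleading≈0 Xᵏ-1 r roots r-injective ⟩
    0                       ∎
    where
    Xᵏ-1 : Vec ℕ (suc (suc d))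
    Xᵏ-1 = (p ∸ 1) ∷ replicate (suc d) 0
    roots : ∀ i → evalMonic Xᵏ-1 (r i) ≈ 0
    roots i = begin
      (p ∸ 1) + r i * evalMonic (replicate (suc d) 0) (r i)
                                    ≡⟨ cong (λ t → (p ∸ 1) + r i * t) (evalMonic-replicate (suc d) (r i)) ⟩
      (p ∸ 1) + r i ^ suc (suc d)   ≈⟨ +-cong (≈-refl {p ∸ 1}) (r^k≈1 i) ⟩
      (p ∸ 1) + 1                   ≡⟨ trans (+-comm (p ∸ 1) 1) (suc-pred p) ⟩
      p                             ≈⟨ p≈0 ⟩
      0                             ∎

module _ {p : ℕ} where

  weightedSum-cong : ∀ m I {a a′ x x′ : Fin m → Fin p} → (∀ i → a i ≡ a′ i) → (∀ i → x i ≡ x′ i) →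
                     weightedSum m I a x ≡ weightedSum m I a′ x′
  weightedSum-cong zero    I            a≗a′ x≗x′ = refl
  weightedSum-cong (suc m) (inside ∷ I) a≗a′ x≗x′ =
    cong₂ _+_ (cong₂ (λ u v → toℕ u * toℕ v) (a≗a′ zero) (x≗x′ zero))
              (weightedSum-cong m I (a≗a′ ∘ suc) (x≗x′ ∘ suc))
  weightedSum-cong (suc m) (outside ∷ I) a≗a′ x≗x′ = weightedSum-cong m I (a≗a′ ∘ suc) (x≗x′ ∘ suc)

  weightedSum-⊥ : ∀ m (a x : Fin m → Fin p) → weightedSum m ⊥ a x ≡ 0
  weightedSum-⊥ zero    a x = refl
  weightedSum-⊥ (suc m) a x = weightedSum-⊥ m (a ∘ suc) (x ∘ suc)

  weightedSum-⁅⁆ : ∀ m i (a x : Fin m → Fin p) → weightedSum m ⁅ i ⁆ a x ≡ toℕ (a i) * toℕ (x i)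
  weightedSum-⁅⁆ (suc m) zero    a x =
    trans (cong (toℕ (a zero) * toℕ (x zero) +_) (weightedSum-⊥ m (a ∘ suc) (x ∘ suc))) (+-identityʳ _)
  weightedSum-⁅⁆ (suc m) (suc i) a x = weightedSum-⁅⁆ m i (a ∘ suc) (x ∘ suc)

  weightedSum-⁅⁆∪⁅⁆ : ∀ m {i j} (a x : Fin m → Fin p) → i ≢ j →
                     weightedSum m (⁅ i ⁆ ∪ ⁅ j ⁆) a x ≡ toℕ (a i) * toℕ (x i) + toℕ (a j) * toℕ (x j)
  weightedSum-⁅⁆∪⁅⁆ (suc m) {zero}  {zero}  a x i≢j = contradiction refl i≢j
  weightedSum-⁅⁆∪⁅⁆ (suc m) {zero}  {suc j} a x _ = cong (toℕ (a zero) * toℕ (x zero) +_) (begin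
    weightedSum m (⊥ ∪ ⁅ j ⁆) (a ∘ suc) (x ∘ suc) ≡⟨ cong (λ I → weightedSum m I (a ∘ suc) (x ∘ suc)) (∪-identityˡ ⁅ j ⁆) ⟩
    weightedSum m ⁅ j ⁆ (a ∘ suc) (x ∘ suc)       ≡⟨ weightedSum-⁅⁆ m j (a ∘ suc) (x ∘ suc) ⟩
    toℕ (a (suc j)) * toℕ (x (suc j))            ∎)
    where open ≡-Reasoning
  weightedSum-⁅⁆∪⁅⁆ (suc m) {suc i} {zero}  a x _ = begin
    toℕ (a zero) * toℕ (x zero) + weightedSum m (⁅ i ⁆ ∪ ⊥) (a ∘ suc) (x ∘ suc)
      ≡⟨ cong (λ I → toℕ (a zero) * toℕ (x zero) + weightedSum m I (a ∘ suc) (x ∘ suc)) (∪-identityʳ ⁅ i ⁆) ⟩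
    toℕ (a zero) * toℕ (x zero) + weightedSum m ⁅ i ⁆ (a ∘ suc) (x ∘ suc)
      ≡⟨ cong (toℕ (a zero) * toℕ (x zero) +_) (weightedSum-⁅⁆ m i (a ∘ suc) (x ∘ suc)) ⟩
    toℕ (a zero) * toℕ (x zero) + toℕ (a (suc i)) * toℕ (x (suc i))
      ≡⟨ +-comm (toℕ (a zero) * toℕ (x zero)) _ ⟩
    toℕ (a (suc i)) * toℕ (x (suc i)) + toℕ (a zero) * toℕ (x zero) ∎
    where open ≡-Reasoning
  weightedSum-⁅⁆∪⁅⁆ (suc m) {suc i} {suc j} a x i≢j = weightedSum-⁅⁆∪⁅⁆ m (a ∘ suc) (x ∘ suc) (i≢j ∘ cong suc)

  weightedSum-⊤ : ∀ m (a x : Fin m → Fin p) → weightedSum m ⊤ a x ≡ sum (λ i → toℕ (a i) * toℕ (x i))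
  weightedSum-⊤ zero    a x = refl
  weightedSum-⊤ (suc m) a x = cong (toℕ (a zero) * toℕ (x zero) +_) (weightedSum-⊤ m (a ∘ suc) (x ∘ suc))

-- Without function extensionality, deciding a property of functions needs it to respect
-- pointwise equality.
module _ {c : ℕ} where

  PointwiseInvariant : ∀ {m} → ((Fin m → Fin c) → Set) → Set
  PointwiseInvariant P = ∀ {f g} → (∀ i → f i ≡ g i) → P f → P g

  private
    ∷-cong : ∀ {m} (a : Fin c) {f g : Fin m → Fin c} → (∀ i → f i ≡ g i) → ∀ i → (a V.∷ f) i ≡ (a V.∷ g) i
    ∷-cong a f≗g zero    = refl
    ∷-cong a f≗g (suc i) = f≗g i

    head∷tail : ∀ {m} (f : Fin (suc m) → Fin c) → ∀ i → (V.head f V.∷ V.tail f) i ≡ f i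
    head∷tail f zero    = refl
    head∷tail f (suc i) = refl

  all-functions? : ∀ m {P : (Fin m → Fin c) → Set} → PointwiseInvariant P → Decidable P → Dec (∀ f → P f)
  all-functions? zero    P-inv P? = map′ (λ P[] f → P-inv (λ ()) P[]) (λ ∀P → ∀P V.[]) (P? V.[])
  all-functions? (suc m) P-inv P? =
    map′ (λ ∀P f → P-inv (head∷tail f) (∀P (V.head f) (V.tail f))) (λ ∀P a g → ∀P (a V.∷ g))
      (Fin.all? λ a → all-functions? m (P-inv ∘ ∷-cong a) (P? ∘ (a V.∷_)))

  any-function? : ∀ m {P : (Fin m → Fin c) → Set} → PointwiseInvariant P → Decidable P → Dec (∃ P)
  any-function? zero    P-inv P? = map′ (λ P[] → V.[] , P[]) (λ (f , Pf) → P-inv (λ ()) Pf) (P? V.[])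
  any-function? (suc m) P-inv P? =
    map′ (λ (a , g , Pa∷g) → a V.∷ g , Pa∷g) (λ (f , Pf) → V.head f , V.tail f , P-inv (sym ∘ head∷tail f) Pf)
      (Fin.any? λ a → any-function? m (P-inv ∘ ∷-cong a) (P? ∘ (a V.∷_)))

module _ (p : ℕ) .{{_ : NonZero p}} where

  unitPow? : ∀ k → Decidable (UnitPow p k)
  unitPow? k a = Fin.any? λ x → ¬? (toℕ x ≟ 0) ×-dec ((toℕ x ^ k) % p ≟ toℕ a)

  hasWeightedZeroSum? : ∀ {A} → Decidable A → ∀ m → Decidable (HasWeightedZeroSum p A m)
  hasWeightedZeroSum? {A} A? m x = anySubset? λ I → nonempty? I ×-dec any-function? m (invariant I) (weights? I)
    where
    Weights : Subset m → (Fin m → Fin p) → Set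
    Weights I a = (∀ i → i ∈ I → A (a i)) × (weightedSum m I a x % p ≡ 0)
    weights? : ∀ I → Decidable (Weights I)
    weights? I a = Fin.all? (λ i → i ∈? I →-dec A? (a i)) ×-dec (weightedSum m I a x % p ≟ 0)
    invariant : ∀ I → PointwiseInvariant (Weights I)
    invariant I a≗a′ (a∈A , sum≈0) =
      (λ i i∈I → subst A (a≗a′ i) (a∈A i i∈I)) ,
      trans (cong (_% p) (weightedSum-cong m I (sym ∘ a≗a′) (λ _ → refl))) sum≈0

  allHaveWZS? : ∀ {A} → Decidable A → ∀ m → Dec (AllHaveWZS p A m)
  allHaveWZS? {A} A? m = all-functions? m invariant (hasWeightedZeroSum? A? m)
    where
    invariant : PointwiseInvariant (HasWeightedZeroSum p A m)
    invariant x≗x′ (I , I≢∅ , a , a∈A , sum≈0) =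
      I , I≢∅ , a , a∈A , trans (cong (_% p) (weightedSum-cong m I (λ _ → refl) (sym ∘ x≗x′))) sum≈0

Least : (ℕ → Set) → ℕ → Set
Least P d = P d × (∀ {m} → P m → d ≤ m)

leastWitness : ∀ {P : ℕ → Set} → Decidable P → ∀ {n} → P n → ∃ λ d → d ≤ n × Least P d
leastWitness {P} P? {n} = <-rec (λ n → P n → ∃ λ d → d ≤ n × Least P d) step n
  where
  step : ∀ n → (∀ {m} → m < n → P m → ∃ λ d → d ≤ m × Least P d) → P n → ∃ λ d → d ≤ n × Least P d
  step n rec Pn with anyUpTo? P? n
  ... | yes (m , m<n , Pm) = let d , d≤m , least = rec m<n Pm in d , ≤-trans d≤m (<⇒≤ m<n) , least
  ... | no ∄m<n            = n , ≤-refl , Pn , λ {m} Pm → ≮⇒≥ (λ m<n → ∄m<n (m , m<n , Pm))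

prime∤⇒coprime : ∀ {k n} → Prime k → ¬ k ∣ n → Coprime k n
prime∤⇒coprime prime-k k∤n (d∣k , d∣n) with prime⇒irreducible prime-k d∣k
... | inj₁ d≡1 = d≡1
... | inj₂ refl = contradiction d∣n k∤n

-- Bézout gives 1 ≡ ±(x k − y n); in the unfavourable sign the multiplier n − 1 flips it.
coprime⇒1+bk≡tn : ∀ {k n} .{{_ : NonZero n}} → Coprime k n → ∃₂ λ b t → 1 + b * k ≡ t * n
coprime⇒1+bk≡tn {k} {n@(suc n′)} coprime with coprime-Bézout coprime
... | Bézout.-+ x y 1+xk≡yn = x , y , 1+xk≡yn
... | Bézout.+- x y 1+yn≡xk = n′ * x , 1 + n′ * y , (begin
  1 + n′ * x * k          ≡⟨ cong suc (*-assoc n′ x k) ⟩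
  1 + n′ * (x * k)        ≡⟨ cong (λ t → 1 + n′ * t) 1+yn≡xk ⟨
  1 + n′ * (1 + y * n)    ≡⟨ regroup n′ y ⟩
  (1 + n′ * y) * n        ∎)
  where
  open ≡-Reasoning
  regroup : ∀ n′ y → 1 + n′ * (1 + y * suc n′) ≡ (1 + n′ * y) * suc n′
  regroup = solve-∀

module WeightedZeroSums {p : ℕ} (prime : Prime p) where

  private instance
    p≢0 : NonZero p
    p≢0 = prime⇒nonZero prime

  open PrimeModular prime
  open import Relation.Binary.Reasoning.Setoid ≈-setoid

  kthRootExponent : ∀ {k} → Prime k → k ∣ p ∸ 1 → ¬ k * k ∣ p ∸ 1 →
                    ∃ λ b → ∀ {u} → ¬ u ≈ 0 → (u * (u ^ b) ^ k) ^ k ≈ 1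
  kthRootExponent {k} prime-k (divides n p∸1≡n*k) k²∤p∸1
    with coprime⇒1+bk≡tn {{n≢0}} (prime∤⇒coprime prime-k k∤n)
    where
    k∤n : ¬ k ∣ n
    k∤n k∣n = k²∤p∸1 (subst (k * k ∣_) (sym p∸1≡n*k) (*-monoˡ-∣ k k∣n))
    n≢0 : NonZero n
    n≢0 = ≢-nonZero λ n≡0 → <⇒≱ (nonTrivial⇒n>1 p {{prime⇒nonTrivial prime}})
                              (m∸n≡0⇒m≤n (trans p∸1≡n*k (cong (_* k) n≡0)))
  ... | b , t , 1+bk≡tn = b , λ {u} u≉0 → begin
    (u * (u ^ b) ^ k) ^ k   ≡⟨ cong (λ v → (u * v) ^ k) (^-*-assoc u b k) ⟩
    (u ^ (1 + b * k)) ^ k   ≡⟨ ^-*-assoc u (1 + b * k) k ⟩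
    u ^ ((1 + b * k) * k)   ≡⟨ cong (λ e → u ^ (e * k)) 1+bk≡tn ⟩
    u ^ (t * n * k)         ≡⟨ cong (u ^_) (regroup t n k) ⟩
    u ^ ((n * k) * t)       ≡⟨ ^-*-assoc u (n * k) t ⟨
    (u ^ (n * k)) ^ t       ≡⟨ cong (λ e → (u ^ e) ^ t) p∸1≡n*k ⟨
    (u ^ (p ∸ 1)) ^ t       ≈⟨ ^-congˡ t (fermat-^[p∸1] u≉0) ⟩
    1 ^ t                   ≡⟨ ^-zeroˡ t ⟩
    1                       ∎
    where
    regroup : ∀ t n k → t * n * k ≡ (n * k) * t
    regroup = solve-∀

  residue : ℕ → Fin p
  residue v = fromℕ< (m%n<n v p)

  toℕ-residue : ∀ v → toℕ (residue v) ≡ v % p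
  toℕ-residue v = Fin.toℕ-fromℕ< (m%n<n v p)

  toℕ-residue-≈ : ∀ v → toℕ (residue v) ≈ v
  toℕ-residue-≈ v = trans (cong (_% p) (toℕ-residue v)) (%-≈ v)

  module _ (k : ℕ) where

    kthPower : ℕ → Fin p
    kthPower v = residue (v ^ k)

    kthPower-∈ : ∀ {v} → ¬ v ≈ 0 → UnitPow p k (kthPower v)
    kthPower-∈ {v} v≉0 =
      residue v ,
      (λ r≡0 → v≉0 (≈-trans (≈-sym (toℕ-residue-≈ v)) (≡⇒≈ r≡0))) ,
      trans (^-congˡ k (toℕ-residue-≈ v)) (sym (toℕ-residue (v ^ k)))

  module _ {k : ℕ} (k-odd : ¬ 2 ∣ k) (2≤k : 2 ≤ k) {b : ℕ}
           (ζ-root : ∀ {u} → ¬ u ≈ 0 → (u * (u ^ b) ^ k) ^ k ≈ 1) where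

    private
      A : Fin p → Set
      A = UnitPow p k

    ζ : ℕ → ℕ
    ζ u = u * (u ^ b) ^ k

    weight : ℕ → Fin p
    weight u = kthPower k (u ^ b)

    negWeight : ℕ → Fin p
    negWeight u = kthPower k (neg (u ^ b))

    weight-∈ : ∀ {u} → ¬ u ≈ 0 → A (weight u)
    weight-∈ u≉0 = kthPower-∈ k (^-≉0 b u≉0)

    negWeight-∈ : ∀ {u} → ¬ u ≈ 0 → A (negWeight u)
    negWeight-∈ u≉0 = kthPower-∈ k (neg-≉0 (^-≉0 b u≉0))

    weight-* : ∀ u → toℕ (weight u) * u ≈ ζ u
    weight-* u = ≈-trans (*-cong (toℕ-residue-≈ ((u ^ b) ^ k)) (≈-refl {u})) (≡⇒≈ (*-comm ((u ^ b) ^ k) u))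

    weight-*+negWeight-*≈0 : ∀ {u w} → ζ u ≈ ζ w → toℕ (weight u) * u + toℕ (negWeight w) * w ≈ 0
    weight-*+negWeight-*≈0 {u} {w} ζu≈ζw = begin
      toℕ (weight u) * u + toℕ (negWeight w) * w
        ≈⟨ +-cong (≈-trans (weight-* u) ζu≈ζw) (*-cong (toℕ-residue-≈ (neg v ^ k)) (≈-refl {w})) ⟩
      w * v ^ k + neg v ^ k * w     ≡⟨ cong (_+ neg v ^ k * w) (*-comm w (v ^ k)) ⟩
      v ^ k * w + neg v ^ k * w     ≡⟨ *-distribʳ-+ w (v ^ k) (neg v ^ k) ⟨
      (v ^ k + neg v ^ k) * w       ≈⟨ *-cong (odd-^-+≈0 k k-odd (+-neg≈0 v)) (≈-refl {w}) ⟩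
      0                             ∎
      where
      v : ℕ
      v = w ^ b

    singletonZeroSum : ∀ {m} (x : Fin m → Fin p) {i} → toℕ (x i) ≈ 0 → HasWeightedZeroSum p A m x
    singletonZeroSum {m} x {i} xᵢ≈0 = ⁅ i ⁆ , (i , x∈⁅x⁆ i) , const one , (λ _ _ → weight-∈ 1≉0) , ≈0⇒%≡0 (begin
      weightedSum m ⁅ i ⁆ (const one) x   ≡⟨ weightedSum-⁅⁆ m i (const one) x ⟩
      toℕ one * toℕ (x i)                 ≈⟨ *-cong (≈-refl {toℕ one}) xᵢ≈0 ⟩
      toℕ one * 0                         ≡⟨ *-zeroʳ (toℕ one) ⟩
      0                                   ∎)
      where
      one : Fin p
      one = weight 1

    pairZeroSum : ∀ {m} (x : Fin m → Fin p) {i j} → i ≢ j → ¬ toℕ (x i) ≈ 0 → ¬ toℕ (x j) ≈ 0 →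
                  ζ (toℕ (x i)) ≈ ζ (toℕ (x j)) → HasWeightedZeroSum p A m x
    pairZeroSum {m} x {i} {j} i≢j xᵢ≉0 xⱼ≉0 ζxᵢ≈ζxⱼ =
      ⁅ i ⁆ ∪ ⁅ j ⁆ , (i , x∈p∪q⁺ (inj₁ (x∈⁅x⁆ i))) , a , (λ l _ → a-∈ l) , ≈0⇒%≡0 (begin
        weightedSum m (⁅ i ⁆ ∪ ⁅ j ⁆) a x              ≡⟨ weightedSum-⁅⁆∪⁅⁆ m a x i≢j ⟩
        toℕ (a i) * xᵢ + toℕ (a j) * xⱼ                ≡⟨ cong₂ (λ u v → toℕ u * xᵢ + toℕ v * xⱼ)
                                                             (updateAt-minimal i j _ i≢j) (updateAt-updates j _) ⟩
        toℕ (weight xᵢ) * xᵢ + toℕ (negWeight xⱼ) * xⱼ ≈⟨ weight-*+negWeight-*≈0 ζxᵢ≈ζxⱼ ⟩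
        0                                              ∎)
      where
      xᵢ xⱼ : ℕ
      xᵢ = toℕ (x i)
      xⱼ = toℕ (x j)
      a : Fin m → Fin p
      a = V.updateAt (const (weight xᵢ)) j (const (negWeight xⱼ))
      a-∈ : ∀ l → A (a l)
      a-∈ l with l Fin.≟ j
      ... | yes refl = subst A (sym (updateAt-updates j _)) (negWeight-∈ xⱼ≉0)
      ... | no  l≢j  = subst A (sym (updateAt-minimal l j _ l≢j)) (weight-∈ xᵢ≉0)

    fullZeroSum : (x : Fin k → Fin p) → (∀ l → ¬ toℕ (x l) ≈ 0) → Injective _≡_ _≈_ (ζ ∘ toℕ ∘ x) →
                  HasWeightedZeroSum p A k x
    fullZeroSum x x≉0 ζx-injective =
      ⊤ , (fromℕ< (≤-trans (s≤s z≤n) 2≤k) , ∈⊤) , a , (λ l _ → weight-∈ (x≉0 l)) , ≈0⇒%≡0 (begin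
        weightedSum k ⊤ a x                 ≡⟨ weightedSum-⊤ k a x ⟩
        sum (λ l → toℕ (a l) * toℕ (x l))   ≈⟨ sum-cong (weight-* ∘ toℕ ∘ x) ⟩
        sum (ζ ∘ toℕ ∘ x)                   ≈⟨ sum-rootsOfUnity≈0 2≤k (ζ ∘ toℕ ∘ x) (ζ-root ∘ x≉0) ζx-injective ⟩
        0                                   ∎)
      where
      a : Fin k → Fin p
      a = weight ∘ toℕ ∘ x

    allHaveWZS : AllHaveWZS p A k
    allHaveWZS x with Fin.any? (λ i → toℕ (x i) ≈? 0)
    ... | yes (i , xᵢ≈0) = singletonZeroSum x xᵢ≈0
    ... | no ∄xᵢ≈0 with Fin.any? (λ i → Fin.any? λ j → ¬? (i Fin.≟ j) ×-dec (ζ (toℕ (x i)) ≈? ζ (toℕ (x j))))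
    ...   | yes (i , j , i≢j , ζxᵢ≈ζxⱼ) = pairZeroSum x i≢j (∄xᵢ≈0 ∘ (i ,_)) (∄xᵢ≈0 ∘ (j ,_)) ζxᵢ≈ζxⱼ
    ...   | no ∄pair = fullZeroSum x (λ l → ∄xᵢ≈0 ∘ (l ,_)) ζx-injective
      where
      ζx-injective : Injective _≡_ _≈_ (ζ ∘ toℕ ∘ x)
      ζx-injective {i} {j} ζxᵢ≈ζxⱼ = decidable-stable (i Fin.≟ j) λ i≢j → ∄pair (i , j , i≢j , ζxᵢ≈ζxⱼ)

mainTheorem8 : (p k : ℕ) .{{_ : NonZero p}} → Prime p → Prime k →
    ¬ (2 ∣ p) → ¬ (2 ∣ k) → k ∣ (p ∸ 1) → ¬ (k * k ∣ (p ∸ 1)) →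
    Σ ℕ λ d → IsDavenportA p (UnitPow p k) d × d ≤ k
mainTheorem8 p k {{p≢0}} prime-p prime-k _ k-odd k∣p∸1 k²∤p∸1 =
  let b , ζ-root = WeightedZeroSums.kthRootExponent prime-p prime-k k∣p∸1 k²∤p∸1
      2≤k = nonTrivial⇒n>1 k {{prime⇒nonTrivial prime-k}}
      d , d≤k , (1≤d , wzs-d) , d-least =
        leastWitness (λ m → 1 ≤? m ×-dec allHaveWZS? p {{p≢0}} (unitPow? p {{p≢0}} k) m)
                     (≤-trans (s≤s z≤n) 2≤k , WeightedZeroSums.allHaveWZS prime-p k-odd 2≤k {b} ζ-root)
  in d , (1≤d , wzs-d , λ m 1≤m wzs-m → d-least (1≤m , wzs-m)) , d≤k
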